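{- For all positive integers $s,n,m,k$ we have $\psi_s(m,n)\le k\bigl(N^s_k(m)+n\bigr)$.
   Context: A Davenport--Schinzel sequence of order $s$ is a finite sequence with no two adjacent equal entries and containing no (not necessarily contiguous) subsequence $a\,b\,a\,b\ldots$ of length $s+2$ with $a\ne b$. $\psi_s(m,n)$ is the maximum length of a Davenport--Schinzel sequence of order $s$ on $n$ distinct symbols that can be partitioned into at most $m$ contiguous blocks, each consisting of distinct symbols. An almost-DS sequence of order $s$ with multiplicity $k$ and $m$ blocks (an $\mathrm{ADS}^s_k(m)$-sequence) is a sequence that is a concatenation of $m$ blocks, each block containing only distinct symbols, in which every symbol appears at least $k$ times, and which contains no alternation $a\,b\,a\,b\ldots$ of length $s+2$ ($a\neq b$); adjacent equal symbols at interfaces between blocks are allowed. $N^s_k(m)$ is the maximum number of distinct symbols in an $\mathrm{ADS}^s_k(m)$-sequence (possibly $\infty$; it is $0$ if $m<k$). -}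

module Defs where

open import Data.Nat using (ℕ; zero; suc; _+_; _≤_)
open import Data.Nat.Properties using (_≟_)
open import Data.Fin using (Fin)
open import Data.List using (List; []; _∷_; concat; length; deduplicate)
open import Data.List.Relation.Unary.All using (All)
open import Data.List.Relation.Unary.Unique.Propositional using (Unique)
open import Data.List.Relation.Unary.Linked using (Linked)
open import Data.List.Relation.Binary.Sublist.Propositional using (_⊆_)
open import Data.List.Membership.Propositional using (_∈_)
open import Data.Product using (Σ; _×_)
open import Relation.Binary.PropositionalEquality using (_≡_; _≢_)
open import Relation.Nullary using (¬_; yes; no)

alt : {A : Set} → A → A → ℕ → List A
alt a b zero = []
alt a b (suc L) = a ∷ alt b a L

HasAlt : {A : Set} → ℕ → List A → Set
HasAlt {A} L xs = Σ A λ a → Σ A λ b → a ≢ b × alt a b L ⊆ xs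

AtMostBlocks : {A : Set} → ℕ → List A → Set
AtMostBlocks {A} m xs =
  Σ (List (List A)) λ bs → concat bs ≡ xs × length bs ≤ m × All Unique bs

ExactBlocks : {A : Set} → ℕ → List A → Set
ExactBlocks {A} m xs =
  Σ (List (List A)) λ bs → concat bs ≡ xs × length bs ≡ m × All Unique bs

IsDS : {A : Set} → ℕ → List A → Set
IsDS s xs = Linked _≢_ xs × ¬ HasAlt (suc (suc s)) xs

occ : ℕ → List ℕ → ℕ
occ x [] = 0
occ x (y ∷ ys) with x ≟ y
... | yes _ = suc (occ x ys)
... | no _ = occ x ys

distinctCount : List ℕ → ℕ
distinctCount xs = length (deduplicate _≟_ xs)

IsADS : ℕ → ℕ → ℕ → List ℕ → Set
IsADS s k m xs =
  ExactBlocks m xs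
  × (∀ {x} → x ∈ xs → k ≤ occ x xs)
  × ¬ HasAlt (suc (suc s)) xs

-- N is an upper bound on the number of distinct symbols of ADS^s_k(m)-sequences,
-- i.e. N^s_k(m) ≤ N  (no such N exists iff N^s_k(m) = ∞)
NBound : ℕ → ℕ → ℕ → ℕ → Set
NBound s k m N = ∀ xs → IsADS s k m xs → distinctCount xs ≤ N

module Submission where

-- Let xs be a DS sequence of order s ≥ 1 over n letters with at most m blocks.
-- Scanning xs from the right, the occurrences of each letter x are cut into
-- consecutive groups of k: the occurrence of x having j later occurrences of x
-- gets the level ⌊j/k⌋, and is relabelled by the fresh symbol (x, ⌊j/k⌋) ∈ ℕ.
-- Every symbol then occurs at most k times, and exactly k times unless its
-- level is the top level of its letter.  Keeping only the non-top symbols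
-- gives an ADS^s_k(m)-sequence: the blocks of xs still cut it into distinct
-- blocks, and an alternation a b a … in it either projects to an alternation
-- in xs (different letters) or is impossible, since levels of one letter
-- decrease from left to right.  So the kept part has at most N^s_k(m)·k
-- entries, while the dropped top symbols are at most n, each occurring at most
-- k times.

open import Defs
open import Data.Nat using (ℕ; zero; suc; _+_; _*_; _∸_; _⊓_; _≤_; _<_; z≤n; s≤s; NonZero; >-nonZero; _/_; _%_; _<?_)
open import Data.Nat.Properties
open import Data.Nat.DivMod
open import Data.Nat.Divisibility using (n∣m*n)
open import Data.Fin as Fin using (Fin; toℕ; fromℕ<)
open import Data.Fin.Properties using (toℕ-injective; toℕ-fromℕ<; toℕ<n)
open import Data.List using (List; []; _∷_; _++_; concat; length; map; filter; deduplicate; tabulate)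
open import Data.List.Properties using (length-map; length-tabulate)
open import Data.List.Relation.Unary.All as All using (All; []; _∷_)
open import Data.List.Relation.Unary.AllPairs using (AllPairs; []; _∷_)
open import Data.List.Relation.Unary.Unique.Propositional using (Unique)
open import Data.List.Relation.Unary.Unique.Propositional.Properties as UniqueProps using ()
open import Data.List.Relation.Binary.Sublist.Propositional using (_⊆_; []; _∷_; _∷ʳ_; ⊆-refl; ⊆-trans; minimum)
open import Data.List.Relation.Binary.Sublist.Propositional.Properties using (All-resp-⊆; filter-⊆) renaming (map⁺ to ⊆-map⁺)
open import Data.List.Membership.Propositional using (_∈_)
open import Data.List.Membership.Propositional.Properties using (∈-filter⁻; ∈-deduplicate⁺; ∈-tabulate⁺)
open import Data.List.Relation.Unary.Any using (here; there)
open import Data.Product using (Σ; _×_; _,_; proj₁; proj₂)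
open import Data.Empty using (⊥-elim)
open import Relation.Binary.PropositionalEquality
open import Relation.Binary using (tri<; tri≈; tri>)
open import Relation.Nullary using (¬_; Dec; yes; no; ¬?)
open import Function using (_∘_)

occ-here : ∀ d ws → occ d (d ∷ ws) ≡ suc (occ d ws)
occ-here d ws with d ≟ d
... | yes _ = refl
... | no d≢d = ⊥-elim (d≢d refl)

occ-there : ∀ {d w} ws → d ≢ w → occ d (w ∷ ws) ≡ occ d ws
occ-there {d} {w} ws d≢w with d ≟ w
... | yes d≡w = ⊥-elim (d≢w d≡w)
... | no _ = refl

occ-⊆ : ∀ d {vs ws} → vs ⊆ ws → occ d vs ≤ occ d ws
occ-⊆ d [] = z≤n
occ-⊆ d (w ∷ʳ p) with d ≟ w
... | yes _ = m≤n⇒m≤1+n (occ-⊆ d p)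
... | no _ = occ-⊆ d p
occ-⊆ d {v ∷ _} (refl ∷ p) with d ≟ v
... | yes _ = s≤s (occ-⊆ d p)
... | no _ = occ-⊆ d p

∈⇒occ-pos : ∀ {d ws} → d ∈ ws → 0 < occ d ws
∈⇒occ-pos {d} {_ ∷ ws} (here refl) rewrite occ-here d ws = s≤s z≤n
∈⇒occ-pos {d} {w ∷ _} (there p) = ≤-trans (∈⇒occ-pos p) (occ-⊆ d (w ∷ʳ ⊆-refl))

occ-filter : ∀ {P : ℕ → Set} (P? : ∀ x → Dec (P x)) {d} ws → P d →
             occ d (filter P? ws) ≡ occ d ws
occ-filter P? [] _ = refl
occ-filter P? {d} (w ∷ ws) Pd with P? w
... | yes _ with d ≟ w
...   | yes _ = cong suc (occ-filter P? ws Pd)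
...   | no _ = occ-filter P? ws Pd
occ-filter P? {d} (w ∷ ws) Pd | no ¬Pw with d ≟ w
...   | yes refl = ⊥-elim (¬Pw Pd)
...   | no _ = occ-filter P? ws Pd

length-filter-split : ∀ {A : Set} {P : A → Set} (P? : ∀ x → Dec (P x)) ws →
                      length ws ≡ length (filter P? ws) + length (filter (¬? ∘ P?) ws)
length-filter-split P? [] = refl
length-filter-split P? (w ∷ ws) with P? w
... | yes _ = cong suc (length-filter-split P? ws)
... | no _ = trans (cong suc (length-filter-split P? ws)) (sym (+-suc _ _))

occSum : List ℕ → List ℕ → ℕ
occSum [] ws = 0
occSum (d ∷ D) ws = occ d ws + occSum D ws

occSum-cons : ∀ D w ws → w ∈ D → suc (occSum D ws) ≤ occSum D (w ∷ ws)
occSum-cons (_ ∷ D) w ws (here refl) rewrite occ-here w ws =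
  s≤s (+-monoʳ-≤ (occ w ws) (occSum-mono D))
  where
  occSum-mono : ∀ D′ → occSum D′ ws ≤ occSum D′ (w ∷ ws)
  occSum-mono [] = z≤n
  occSum-mono (d ∷ D′) = +-mono-≤ (occ-⊆ d (w ∷ʳ ⊆-refl)) (occSum-mono D′)
occSum-cons (d ∷ D) w ws (there w∈D) =
  ≤-trans (≤-reflexive (sym (+-suc (occ d ws) (occSum D ws))))
          (+-mono-≤ (occ-⊆ d (w ∷ʳ ⊆-refl)) (occSum-cons D w ws w∈D))

length≤occSum : ∀ ws D → (∀ {w} → w ∈ ws → w ∈ D) → length ws ≤ occSum D ws
length≤occSum [] D _ = z≤n
length≤occSum (w ∷ ws) D ws⊆D =
  ≤-trans (s≤s (length≤occSum ws D (ws⊆D ∘ there))) (occSum-cons D w ws (ws⊆D (here refl)))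

length-≤-support : ∀ k {ws} D → (∀ {w} → w ∈ ws → w ∈ D) → (∀ d → occ d ws ≤ k) →
                   length ws ≤ length D * k
length-≤-support k {ws} D ws⊆D occ≤k = ≤-trans (length≤occSum ws D ws⊆D) (occSum≤ D)
  where
  occSum≤ : ∀ D′ → occSum D′ ws ≤ length D′ * k
  occSum≤ [] = z≤n
  occSum≤ (d ∷ D′) = +-mono-≤ (occ≤k d) (occSum≤ D′)

AllPairs-⊆ : ∀ {A : Set} {R : A → A → Set} {xs ys} → xs ⊆ ys → AllPairs R ys → AllPairs R xs
AllPairs-⊆ [] [] = []
AllPairs-⊆ (_ ∷ʳ p) (_ ∷ rs) = AllPairs-⊆ p rs
AllPairs-⊆ (refl ∷ p) (r ∷ rs) = All-resp-⊆ p r ∷ AllPairs-⊆ p rs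

Unique-⊆-map : ∀ {A B : Set} (f : A → B) {ws b} → map f ws ⊆ b → Unique b → Unique ws
Unique-⊆-map f p u = UniqueProps.map⁻ (AllPairs-⊆ p u)

split-⊆-++ : ∀ {A B : Set} (f : A → B) (b rest : List B) ws → map f ws ⊆ b ++ rest →
             Σ (List A) λ w₁ → Σ (List A) λ w₂ →
               w₁ ++ w₂ ≡ ws × map f w₁ ⊆ b × map f w₂ ⊆ rest
split-⊆-++ f [] rest ws p = [] , ws , refl , [] , p
split-⊆-++ f (y ∷ b) rest [] p = [] , [] , refl , minimum _ , minimum _
split-⊆-++ f (y ∷ b) rest (w ∷ ws) (.y ∷ʳ p) with split-⊆-++ f b rest (w ∷ ws) p
... | w₁ , w₂ , e , p₁ , p₂ = w₁ , w₂ , e , y ∷ʳ p₁ , p₂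
split-⊆-++ f (y ∷ b) rest (w ∷ ws) (fw≡y ∷ p) with split-⊆-++ f b rest ws p
... | w₁ , w₂ , e , p₁ , p₂ = w ∷ w₁ , w₂ , cong (w ∷_) e , fw≡y ∷ p₁ , p₂

blocks-⊆ : ∀ {A B : Set} (f : A → B) (bs : List (List B)) ws →
           map f ws ⊆ concat bs → All Unique bs →
           Σ (List (List A)) λ cs → concat cs ≡ ws × length cs ≡ length bs × All Unique cs
blocks-⊆ f [] [] _ _ = [] , refl , refl , []
blocks-⊆ f [] (_ ∷ _) () _
blocks-⊆ f (b ∷ bs) ws p (ub ∷ ubs) with split-⊆-++ f b (concat bs) ws p
... | w₁ , w₂ , refl , p₁ , p₂ with blocks-⊆ f bs w₂ p₂ ubs
... | cs , refl , len , ucs = w₁ ∷ cs , refl , cong suc len , Unique-⊆-map f p₁ ub ∷ ucs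

pad-blocks : ∀ {A : Set} j (cs : List (List A)) → All Unique cs →
             ExactBlocks (j + length cs) (concat cs)
pad-blocks zero cs ucs = cs , refl , refl , ucs
pad-blocks (suc j) cs ucs with pad-blocks j cs ucs
... | bs , e , len , ubs = [] ∷ bs , e , cong suc len , [] ∷ ubs

exactBlocks-⊆ : ∀ {A B : Set} m (f : A → B) {ws xs} → map f ws ⊆ xs →
                AtMostBlocks m xs → ExactBlocks m ws
exactBlocks-⊆ m f {ws} p (bs , refl , len , ubs) with blocks-⊆ f bs ws p ubs
... | cs , refl , lencs , ucs =
  subst (λ j → ExactBlocks j (concat cs)) (m∸n+n≡m (subst (_≤ m) (sym lencs) len))
        (pad-blocks (m ∸ length cs) cs ucs)

alt-map : ∀ {A B : Set} (f : A → B) a b L → map f (alt a b L) ≡ alt (f a) (f b) L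
alt-map f a b zero = refl
alt-map f a b (suc L) = cong (f a ∷_) (alt-map f b a L)

HasAlt-map : ∀ {A B : Set} (f : A → B) {L ws a b} → f a ≢ f b → alt a b L ⊆ ws →
             HasAlt L (map f ws)
HasAlt-map f {L} {ws} {a} {b} fa≢fb sub =
  f a , f b , fa≢fb , subst (_⊆ map f ws) (alt-map f a b L) (⊆-map⁺ f sub)

alt-AllPairs : ∀ {A : Set} {R : A → A → Set} {ws a b} L → AllPairs R ws →
               alt a b (3 + L) ⊆ ws → R a b × R b a
alt-AllPairs L rs sub with AllPairs-⊆ sub rs
... | (Rab ∷ _) ∷ (Rba ∷ _) ∷ _ = Rab , Rba

module Labelling (n k : ℕ) .{{_ : NonZero n}} .{{_ : NonZero k}} where

  -- The symbol (x, g) ∈ Fin n × ℕ, encoded injectively in ℕ, and its decoding.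
  enc : Fin n → ℕ → ℕ
  enc x g = toℕ x + g * n

  letter : ℕ → Fin n
  letter d = fromℕ< (m%n<n d n)

  level : ℕ → ℕ
  level d = d / n

  letter-enc : ∀ x g → letter (enc x g) ≡ x
  letter-enc x g = toℕ-injective (begin
    toℕ (letter (enc x g))  ≡⟨ toℕ-fromℕ< _ ⟩
    (toℕ x + g * n) % n     ≡⟨ [m+kn]%n≡m%n (toℕ x) g n ⟩
    toℕ x % n               ≡⟨ m<n⇒m%n≡m (toℕ<n x) ⟩
    toℕ x                   ∎)
    where open ≡-Reasoning

  level-enc : ∀ x g → level (enc x g) ≡ g
  level-enc x g = begin
    (toℕ x + g * n) / n    ≡⟨ +-distrib-/-∣ʳ (toℕ x) (n∣m*n g) ⟩
    toℕ x / n + g * n / n  ≡⟨ cong₂ _+_ (m<n⇒m/n≡0 (toℕ<n x)) (m*n/n≡m g n) ⟩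
    g                      ∎
    where open ≡-Reasoning

  enc-letter-level : ∀ d → enc (letter d) (level d) ≡ d
  enc-letter-level d = begin
    toℕ (letter d) + d / n * n  ≡⟨ cong (_+ d / n * n) (toℕ-fromℕ< _) ⟩
    d % n + d / n * n           ≡⟨ m≡m%n+[m/n]*n d n ⟨
    d                           ∎
    where open ≡-Reasoning

  letter-level-injective : ∀ {d e} → letter d ≡ letter e → level d ≡ level e → d ≡ e
  letter-level-injective {d} {e} same-letter same-level =
    trans (sym (enc-letter-level d))
          (trans (cong₂ enc same-letter same-level) (enc-letter-level e))

  -- window c g = #{ j < c | ⌊j/k⌋ = g }: among c occurrences of a letter,
  -- the number that receive level g.
  window : ℕ → ℕ → ℕ
  window c g = (c ∸ g * k) ⊓ k

  -- c lies below the end of the group of level ⌊c/k⌋, hence below every higher group.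
  below-higher-level : ∀ c {g} → c / k < g → c < g * k
  below-higher-level c {g} c/k<g = begin-strict
    c                  ≡⟨ m≡m%n+[m/n]*n c k ⟩
    c % k + c / k * k  <⟨ +-monoˡ-< (c / k * k) (m%n<n c k) ⟩
    k + c / k * k      ≤⟨ *-monoˡ-≤ k c/k<g ⟩
    g * k              ∎
    where open ≤-Reasoning

  window-below : ∀ {c g} → g < c / k → window c g ≡ k
  window-below {c} {g} g<c/k = m≥n⇒m⊓n≡n (m+n≤o⇒m≤o∸n k (begin
    k + g * k  ≤⟨ *-monoˡ-≤ k g<c/k ⟩
    c / k * k  ≤⟨ m/n*n≤m c k ⟩
    c          ∎))
    where open ≤-Reasoning

  window-above : ∀ {c} g → c ≤ g * k → window c g ≡ 0
  window-above _ c≤gk = cong (_⊓ k) (m≤n⇒m∸n≡0 c≤gk)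

  window-pos : ∀ {c g} → 0 < window c g → g ≤ c / k
  window-pos {c} {g} pos = ≮⇒≥ λ c/k<g →
    <-irrefl (sym (window-above g (<⇒≤ (below-higher-level c c/k<g)))) pos

  window-here : ∀ c → window (suc c) (c / k) ≡ suc (window c (c / k))
  window-here c = begin
    (suc c ∸ c / k * k) ⊓ k    ≡⟨ cong (_⊓ k) (+-∸-assoc 1 (m/n*n≤m c k)) ⟩
    suc (c ∸ c / k * k) ⊓ k    ≡⟨ cong (λ r → suc r ⊓ k) (m%n≡m∸m/n*n c k) ⟨
    suc (c % k) ⊓ k            ≡⟨ m≤n⇒m⊓n≡m (m%n<n c k) ⟩
    suc (c % k)                ≡⟨ cong suc (m≤n⇒m⊓n≡m (<⇒≤ (m%n<n c k))) ⟨
    suc (c % k ⊓ k)            ≡⟨ cong (λ r → suc (r ⊓ k)) (m%n≡m∸m/n*n c k) ⟩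
    suc (window c (c / k))     ∎
    where open ≡-Reasoning

  window-elsewhere : ∀ c {g} → g ≢ c / k → window (suc c) g ≡ window c g
  window-elsewhere c {g} g≢c/k with <-cmp g (c / k)
  ... | tri< g<c/k _ _ =
    trans (window-below (<-≤-trans g<c/k (/-monoˡ-≤ k (n≤1+n c)))) (sym (window-below g<c/k))
  ... | tri≈ _ g≡c/k _ = ⊥-elim (g≢c/k g≡c/k)
  ... | tri> _ _ c/k<g =
    trans (window-above g (below-higher-level c c/k<g))
          (sym (window-above g (<⇒≤ (below-higher-level c c/k<g))))

  count : Fin n → List (Fin n) → ℕ
  count x [] = 0
  count x (y ∷ ys) with x Fin.≟ y
  ... | yes _ = suc (count x ys)
  ... | no _ = count x ys

  -- level of the group that the next occurrence of x to the left would join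
  topLevel : List (Fin n) → Fin n → ℕ
  topLevel xs x = count x xs / k

  label : List (Fin n) → List ℕ
  label [] = []
  label (x ∷ xs) = enc x (topLevel xs x) ∷ label xs

  letters-label : ∀ xs → map letter (label xs) ≡ xs
  letters-label [] = refl
  letters-label (x ∷ xs) = cong₂ _∷_ (letter-enc x (topLevel xs x)) (letters-label xs)

  occ-label : ∀ xs x g → occ (enc x g) (label xs) ≡ window (count x xs) g
  occ-label [] x g = sym (window-above g z≤n)
  occ-label (y ∷ ys) x g with x Fin.≟ y
  ... | no x≢y = trans (occ-there (label ys) (x≢y ∘ different-letter)) (occ-label ys x g)
    where
    different-letter : enc x g ≡ enc y (topLevel ys y) → x ≡ y
    different-letter e = trans (sym (letter-enc x g)) (trans (cong letter e) (letter-enc y (topLevel ys y)))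
  ... | yes refl with g ≟ topLevel ys x
  ...   | yes refl = trans (occ-here _ (label ys)) (trans (cong suc (occ-label ys x g))
                       (sym (window-here (count x ys))))
  ...   | no g≢top = trans (occ-there (label ys) (g≢top ∘ different-level))
                       (trans (occ-label ys x g) (sym (window-elsewhere (count x ys) g≢top)))
    where
    different-level : enc x g ≡ enc x (topLevel ys x) → g ≡ topLevel ys x
    different-level e = trans (sym (level-enc x g)) (trans (cong level e) (level-enc x _))

  occ-label′ : ∀ xs d → occ d (label xs) ≡ window (count (letter d) xs) (level d)
  occ-label′ xs d = subst (λ e → occ e (label xs) ≡ window (count (letter d) xs) (level d))
                          (enc-letter-level d) (occ-label xs (letter d) (level d))

  occ-label≤k : ∀ xs d → occ d (label xs) ≤ k
  occ-label≤k xs d = ≤-trans (≤-reflexive (occ-label′ xs d)) (m⊓n≤n _ k)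

  level≤topLevel : ∀ xs {l} → l ∈ label xs → level l ≤ topLevel xs (letter l)
  level≤topLevel xs {l} l∈ = window-pos (subst (0 <_) (occ-label′ xs l) (∈⇒occ-pos l∈))

  SameLetterDescends : ℕ → ℕ → Set
  SameLetterDescends l l′ = letter l ≡ letter l′ → level l′ ≤ level l

  label-descending : ∀ xs → AllPairs SameLetterDescends (label xs)
  label-descending [] = []
  label-descending (x ∷ xs) = All.tabulate descends ∷ label-descending xs
    where
    open ≤-Reasoning
    head = enc x (topLevel xs x)
    descends : ∀ {l′} → l′ ∈ label xs → SameLetterDescends head l′
    descends {l′} l′∈ same = begin
      level l′                   ≤⟨ level≤topLevel xs l′∈ ⟩
      topLevel xs (letter l′)    ≡⟨ cong (topLevel xs) (trans (sym same) (letter-enc x (topLevel xs x))) ⟩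
      topLevel xs x              ≡⟨ level-enc x _ ⟨
      level head                 ∎

  label-alt : ∀ xs L {a b} → a ≢ b → alt a b (3 + L) ⊆ label xs → HasAlt (3 + L) xs
  label-alt xs L {a} {b} a≢b sub with letter a Fin.≟ letter b
  ... | no letters≢ = subst (HasAlt (3 + L)) (letters-label xs) (HasAlt-map letter letters≢ sub)
  ... | yes same = ⊥-elim (a≢b (letter-level-injective same
          (≤-antisym (proj₂ descends (sym same)) (proj₁ descends same))))
    where
    descends = alt-AllPairs L (label-descending xs) sub

  -- A symbol is complete when its group has been filled with k occurrences.
  Complete : List (Fin n) → ℕ → Set
  Complete xs l = level l < topLevel xs (letter l)

  complete? : ∀ xs l → Dec (Complete xs l)
  complete? xs l = level l <? topLevel xs (letter l)

  occ-complete : ∀ xs {l} → Complete xs l → occ l (label xs) ≡ k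
  occ-complete xs {l} c = trans (occ-label′ xs l) (window-below c)

  incomplete-is-top : ∀ xs {l} → l ∈ label xs → ¬ Complete xs l →
                      l ≡ enc (letter l) (topLevel xs (letter l))
  incomplete-is-top xs {l} l∈ ¬c = trans (sym (enc-letter-level l))
    (cong (enc (letter l)) (≤-antisym (level≤topLevel xs l∈) (≮⇒≥ ¬c)))

  completePart incompletePart : List (Fin n) → List ℕ
  completePart xs = filter (complete? xs) (label xs)
  incompletePart xs = filter (¬? ∘ complete? xs) (label xs)

  length-parts : ∀ xs → length xs ≡ length (completePart xs) + length (incompletePart xs)
  length-parts xs = begin
    length xs                                              ≡⟨ cong length (letters-label xs) ⟨
    length (map letter (label xs))                         ≡⟨ length-map letter (label xs) ⟩
    length (label xs)                                      ≡⟨ length-filter-split (complete? xs) (label xs) ⟩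
    length (completePart xs) + length (incompletePart xs)  ∎
    where open ≡-Reasoning

  completePart-ADS : ∀ s m xs → ¬ HasAlt (3 + s) xs → AtMostBlocks m xs →
                     IsADS (suc s) k m (completePart xs)
  completePart-ADS s m xs noAlt blocks =
    exactBlocks-⊆ m letter into-xs blocks , occurs-k , no-alternation
    where
    kept⊆label : completePart xs ⊆ label xs
    kept⊆label = filter-⊆ (complete? xs) (label xs)

    into-xs : map letter (completePart xs) ⊆ xs
    into-xs = subst (map letter (completePart xs) ⊆_) (letters-label xs) (⊆-map⁺ letter kept⊆label)

    occurs-k : ∀ {l} → l ∈ completePart xs → k ≤ occ l (completePart xs)
    occurs-k {l} l∈ = ≤-reflexive (sym (trans (occ-filter (complete? xs) (label xs) c)
                                              (occ-complete xs c)))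
      where c = proj₂ (∈-filter⁻ (complete? xs) {xs = label xs} l∈)

    no-alternation : ¬ HasAlt (3 + s) (completePart xs)
    no-alternation (a , b , a≢b , sub) = noAlt (label-alt xs s a≢b (⊆-trans sub kept⊆label))

  completePart-length : ∀ xs → length (completePart xs) ≤ distinctCount (completePart xs) * k
  completePart-length xs =
    length-≤-support k (deduplicate _≟_ (completePart xs)) (∈-deduplicate⁺ _≟_)
      (λ d → ≤-trans (occ-⊆ d (filter-⊆ (complete? xs) (label xs))) (occ-label≤k xs d))

  -- The incomplete part uses at most the n top symbols, each at most k times.
  incompletePart-length : ∀ xs → length (incompletePart xs) ≤ n * k
  incompletePart-length xs = subst (λ len → length (incompletePart xs) ≤ len * k)
    (length-tabulate topSymbol)
    (length-≤-support k (tabulate topSymbol) among-top-symbols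
      (λ d → ≤-trans (occ-⊆ d (filter-⊆ (¬? ∘ complete? xs) (label xs))) (occ-label≤k xs d)))
    where
    topSymbol : Fin n → ℕ
    topSymbol x = enc x (topLevel xs x)

    among-top-symbols : ∀ {l} → l ∈ incompletePart xs → l ∈ tabulate topSymbol
    among-top-symbols {l} l∈ with ∈-filter⁻ (¬? ∘ complete? xs) {xs = label xs} l∈
    ... | l∈label , ¬c = subst (_∈ tabulate topSymbol) (sym (incomplete-is-top xs l∈label ¬c))
                               (∈-tabulate⁺ (letter l))

lemma4p1 : (s n m k : ℕ) → 1 ≤ s → 1 ≤ n → 1 ≤ m → 1 ≤ k →
    (N : ℕ) → NBound s k m N →
    (xs : List (Fin n)) → IsDS s xs → AtMostBlocks m xs →
    length xs ≤ k * (N + n)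
lemma4p1 (suc s) n m k _ n≥1 _ k≥1 N bound xs (_ , noAlt) blocks = begin
  length xs                                              ≡⟨ length-parts xs ⟩
  length (completePart xs) + length (incompletePart xs)  ≤⟨ +-mono-≤ complete≤ (incompletePart-length xs) ⟩
  N * k + n * k                                          ≡⟨ *-distribʳ-+ k N n ⟨
  (N + n) * k                                            ≡⟨ *-comm (N + n) k ⟩
  k * (N + n)                                            ∎
  where
  open ≤-Reasoning
  open Labelling n k {{>-nonZero n≥1}} {{>-nonZero k≥1}}
  complete≤ : length (completePart xs) ≤ N * k
  complete≤ = ≤-trans (completePart-length xs)
    (*-monoˡ-≤ k (bound (completePart xs) (completePart-ADS s m xs noAlt blocks)))
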